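{- Let $t\geq 3$ be fixed and let $\mathcal{G}$ be the class of $\{K_{1,t},\text{diamond}\}$-free graphs. Let $G$ be a graph and $S\subseteq V(G)$ with $|S|\geq 2$, $G\oplus S\in\mathcal{G}$, and $S$ not an independent set of $G$. Let $u,v\in S$ be adjacent in $G$. Define $N_S(uv)=S\cap N(u)\cap N(v)$, $N_S(\bar u\bar v)=S\cap\overline{N[u]}\cap\overline{N[v]}$, $N_S(u\bar v)=S\cap(N(u)\setminus N[v])$, $N_S(\bar u v)=S\cap(N(v)\setminus N[u])$, $N_T(uv)=(N(u)\cap N(v))\setminus S$, $N_T(\bar u\bar v)=(\overline{N[u]}\cap\overline{N[v]})\setminus S$, $N_T(u\bar v)=(N(u)\setminus N[v])\setminus S$, $N_T(\bar u v)=(N(v)\setminus N[u])\setminus S$. Then: (i) $G[N(u)\setminus N[v]]$ is a $(t-1,t-1)$-split graph with $(t-1,t-1)$-split partition $(N_S(u\bar v),N_T(u\bar v))$; (ii) $G[N(v)\setminus N[u]]$ is a $(t-1,t-1)$-split graph with $(t-1,t-1)$-split partition $(N_S(\bar u v),N_T(\bar u v))$; (iii) $N_T(uv)$ is an independent set in $G$ with at most $t-1$ vertices; (iv) $N_S(\bar u\bar v)$ is a clique in $G$, and if $xy$ is an edge of this clique, then the subgraph of $G$ induced by $J=N[x]\cap N[y]\cap\overline{N[u]}\cap\overline{N[v]}$ is a split graph with a split partition $(N_S(\bar u\bar v),\,J\setminus N_S(\bar u\bar v))$.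
   Context: All graphs are finite and simple. $N(w)$ and $N[w]$ denote open and closed neighborhoods in $G$, and $\overline{X}$ denotes $V(G)\setminus X$. For $S\subseteq V(G)$, $G\oplus S$ is the graph on $V(G)$ where $uv$ is an edge iff either $u,v\in S$ and $uv$ is a nonedge of $G$, or $uv$ is an edge of $G$ and $\{u,v\}\setminus S\neq\emptyset$. The diamond is $K_4$ minus an edge; $K_{1,t}$ is the star with $t$ leaves. A graph is $\mathcal{H}$-free if it has no induced subgraph isomorphic to a member of $\mathcal{H}$. For $p,q\geq1$, a $(p,q)$-split partition of a graph $H$ is a partition $(P,Q)$ of $V(H)$ such that $H[P]$ has clique number at most $p$ (is $K_{p+1}$-free) and $H[Q]$ has independence number at most $q$; $H$ is a $(p,q)$-split graph if it has one. A split graph is one whose vertex set partitions into a clique and an independent set; a split partition is written (clique part, independent part). -}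

module Defs where

open import Data.Nat using (ℕ; zero; suc; _+_; _*_; _≡ᵇ_)
open import Data.Bool using (Bool; true; false; not; _∧_; if_then_else_)
open import Data.Bool.Properties using (∧-zeroʳ; ∧-comm)
open import Data.Fin using (Fin; zero; suc; toℕ; _≟_)
open import Data.Fin.Subset using (Subset; _∈_; _∉_; _∩_; _∪_; _─_; ∁; ⁅_⁆)
open import Data.Vec using (lookup; tabulate)
open import Data.Product using (_×_)
open import Data.Sum using (_⊎_)
open import Data.Empty using (⊥)
open import Function.Definitions using (Injective)
open import Function.Bundles using (_⇔_)
open import Relation.Nullary using (¬_; yes; no)
open import Relation.Nullary.Decidable using (⌊_⌋)
open import Relation.Binary.PropositionalEquality using (_≡_; _≢_; refl; sym; cong)

record Graph (n : ℕ) : Set where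
  field
    adj    : Fin n → Fin n → Bool
    adj-sym : ∀ u v → adj u v ≡ adj v u
    adj-irr : ∀ v → adj v v ≡ false
open Graph public

module _ {n : ℕ} (G : Graph n) where

  N : Fin n → Subset n
  N w = tabulate (adj G w)

  N[_] : Fin n → Subset n
  N[ w ] = N w ∪ ⁅ w ⁆

  IsClique : Subset n → Set
  IsClique A = ∀ x y → x ∈ A → y ∈ A → x ≢ y → adj G x y ≡ true

  IsIndependent : Subset n → Set
  IsIndependent A = ∀ x y → x ∈ A → y ∈ A → adj G x y ≡ false

  CliqueNumberAtMost : ℕ → Subset n → Set
  CliqueNumberAtMost p A =
    (f : Fin (suc p) → Fin n) → Injective _≡_ _≡_ f → (∀ i → f i ∈ A) →
    ¬ (∀ i j → i ≢ j → adj G (f i) (f j) ≡ true)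

  IndependenceNumberAtMost : ℕ → Subset n → Set
  IndependenceNumberAtMost q A =
    (f : Fin (suc q) → Fin n) → Injective _≡_ _≡_ f → (∀ i → f i ∈ A) →
    ¬ (∀ i j → adj G (f i) (f j) ≡ false)

  IsPartitionOf : Subset n → Subset n → Subset n → Set
  IsPartitionOf X P Q = (∀ x → (x ∈ X) ⇔ (x ∈ P ⊎ x ∈ Q)) × (∀ x → x ∈ P → x ∉ Q)

  IsPQSplitPartitionOf : ℕ → ℕ → Subset n → Subset n → Subset n → Set
  IsPQSplitPartitionOf p q X P Q =
    IsPartitionOf X P Q × CliqueNumberAtMost p P × IndependenceNumberAtMost q Q

  IsSplitPartitionOf : Subset n → Subset n → Subset n → Set
  IsSplitPartitionOf X K I = IsPartitionOf X K I × IsClique K × IsIndependent I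

  InducedFree : {k : ℕ} → (Fin k → Fin k → Bool) → Set
  InducedFree {k} H =
    (f : Fin k → Fin n) → Injective _≡_ _≡_ f → ¬ (∀ i j → adj G (f i) (f j) ≡ H i j)

⊕adj : {n : ℕ} → Graph n → Subset n → Fin n → Fin n → Bool
⊕adj G S u v =
  if lookup S u ∧ lookup S v then not (adj G u v) ∧ not ⌊ u ≟ v ⌋ else adj G u v

private
  ≟-sym : {n : ℕ} (u v : Fin n) → ⌊ u ≟ v ⌋ ≡ ⌊ v ≟ u ⌋
  ≟-sym u v with u ≟ v | v ≟ u
  ... | yes _ | yes _ = refl
  ... | no _ | no _ = refl
  ... | yes p | no q = Data.Empty.⊥-elim (q (sym p))
    where import Data.Empty
  ... | no p | yes q = Data.Empty.⊥-elim (p (sym q))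
    where import Data.Empty

  ⊕sym : {n : ℕ} (G : Graph n) (S : Subset n) → ∀ u v → ⊕adj G S u v ≡ ⊕adj G S v u
  ⊕sym G S u v rewrite ∧-comm (lookup S u) (lookup S v)
                     | adj-sym G u v | ≟-sym u v = refl

  ≟-refl : {n : ℕ} (v : Fin n) → ⌊ v ≟ v ⌋ ≡ true
  ≟-refl v with v ≟ v
  ... | yes _ = refl
  ... | no p = Data.Empty.⊥-elim (p refl)
    where import Data.Empty

  ⊕irr : {n : ℕ} (G : Graph n) (S : Subset n) → ∀ v → ⊕adj G S v v ≡ false
  ⊕irr G S v with lookup S v ∧ lookup S v
  ... | true rewrite ≟-refl v = ∧-zeroʳ _
  ... | false = adj-irr G v

_⊕_ : {n : ℕ} → Graph n → Subset n → Graph n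
G ⊕ S = record { adj = ⊕adj G S ; adj-sym = ⊕sym G S ; adj-irr = ⊕irr G S }

starAdj : (t : ℕ) → Fin (suc t) → Fin (suc t) → Bool
starAdj t zero zero = false
starAdj t zero (suc _) = true
starAdj t (suc _) zero = true
starAdj t (suc _) (suc _) = false

-- diamond = K_4 minus the edge {0,3}
diamondAdj : Fin 4 → Fin 4 → Bool
diamondAdj i j =
  not (toℕ i ≡ᵇ toℕ j) ∧ not ((toℕ i + toℕ j ≡ᵇ 3) ∧ (toℕ i * toℕ j ≡ᵇ 0))

InClassG : (t : ℕ) {n : ℕ} → Graph n → Set
InClassG t G = InducedFree G (starAdj t) × InducedFree G diamondAdj

{-# OPTIONS --safe #-}
module Submission where

-- Switching G by S complements G[S] and keeps every other adjacency.  Hence an edge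
-- of G inside S is a non-edge of G ⊕ S, and diamond-freeness of G ⊕ S makes the common
-- neighbours of its ends pairwise non-adjacent there; applied to uv and to xy this gives
-- (iii) and both halves of (iv).  Every set in (i)–(iii) that must be small lies, inside
-- or outside S, in a neighbourhood of u or v in G ⊕ S, which K_{1,t}-freeness gives
-- independence number at most t - 1; inside S, independence in G ⊕ S is cliqueness in G.

open import Defs
open import Data.Nat using (ℕ; _≤_; _∸_; zero; suc; s≤s; _≤?_)
open import Data.Nat.Properties using (≰⇒>)
open import Data.Bool using (true; false; not)
open import Data.Bool.Properties using (∧-zeroʳ; ∧-identityʳ; not-involutive)
open import Data.Fin using (Fin; zero; suc; _≟_)
open import Data.Fin.Properties using (suc-injective)
open import Data.Fin.Subset using (Subset; _∈_; _∉_; _⊆_; _∩_; _─_; ∁; ∣_∣; inside; outside)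
open import Data.Fin.Subset.Properties
  using (x∈p∩q⁺; x∈p∩q⁻; p∩q⊆p; p∩q⊆q; x∈p∪q⁺; x∈p∪q⁻; x∈∁p⇒x∉p;
         x∈⁅x⁆; x∈⁅y⁆⇒x≡y; _∈?_; p─q⊆p; x∈p∧x∉q⇒x∈p─q)
open import Data.Vec using (_∷_; lookup; here; there)
open import Data.Vec.Properties using ([]=⇒lookup; lookup⇒[]=; lookup∘tabulate)
open import Data.Product using (Σ; _×_; _,_; proj₁; proj₂)
open import Data.Sum using (_⊎_; inj₁; inj₂; [_,_]′)
open import Data.Empty using (⊥-elim)
open import Function.Base using (_∘_)
open import Function.Definitions using (Injective)
open import Function.Bundles using (mk⇔)
open import Relation.Nullary using (¬_; yes; no)
open import Relation.Binary.PropositionalEquality using (_≡_; _≢_; refl; sym; trans; cong)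
open Relation.Binary.PropositionalEquality.≡-Reasoning

x∈p─q⇒x∉q : ∀ {n} {p q : Subset n} {x} → x ∈ p ─ q → x ∉ q
x∈p─q⇒x∉q {p = _ ∷ _} {outside ∷ _} here ()
x∈p─q⇒x∉q {p = _ ∷ _} {_ ∷ _} (there x∈p─q) (there x∈q) = x∈p─q⇒x∉q x∈p─q x∈q

x∉p⇒lookup≡false : ∀ {n} (p : Subset n) {x} → x ∉ p → lookup p x ≡ false
x∉p⇒lookup≡false p {x} x∉p with lookup p x in eq
... | true = ⊥-elim (x∉p (lookup⇒[]= x p eq))
... | false = refl

≤∣p∣⇒injection : ∀ {n} (p : Subset n) k → k ≤ ∣ p ∣ →
  Σ (Fin k → Fin n) λ f → Injective _≡_ _≡_ f × (∀ i → f i ∈ p)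
≤∣p∣⇒injection p zero _ = (λ ()) , (λ { {()} }) , λ ()
≤∣p∣⇒injection (outside ∷ p) (suc k) k<∣p∣ with ≤∣p∣⇒injection p (suc k) k<∣p∣
... | f , f-inj , f∈p = suc ∘ f , f-inj ∘ suc-injective , there ∘ f∈p
≤∣p∣⇒injection (inside ∷ p) (suc k) (s≤s k≤∣p∣) with ≤∣p∣⇒injection p k k≤∣p∣
... | f , f-inj , f∈p = g , g-inj , g∈p
  where
    g : Fin (suc k) → Fin _
    g zero = zero
    g (suc i) = suc (f i)
    g-inj : Injective _≡_ _≡_ g
    g-inj {zero} {zero} _ = refl
    g-inj {suc i} {suc j} e = cong suc (f-inj (suc-injective e))
    g∈p : ∀ i → g i ∈ inside ∷ p
    g∈p zero = here
    g∈p (suc i) = there (f∈p i)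

isPartition : ∀ {n} (G : Graph n) {X P Q : Subset n} → P ⊆ X → Q ⊆ X →
  (∀ {x} → x ∈ X → x ∉ P → x ∈ Q) → (∀ {x} → x ∈ P → x ∉ Q) → IsPartitionOf G X P Q
isPartition G {X} {P} {Q} P⊆X Q⊆X cover disjoint =
  (λ x → mk⇔ (divide x) [ P⊆X , Q⊆X ]′) , λ _ → disjoint
  where
    divide : ∀ x → x ∈ X → x ∈ P ⊎ x ∈ Q
    divide x x∈X with x ∈? P
    ... | yes x∈P = inj₁ x∈P
    ... | no x∉P = inj₂ (cover x∈X x∉P)

module _ {n : ℕ} (G : Graph n) where

  adjacent⇒distinct : ∀ {x y} → adj G x y ≡ true → x ≢ y
  adjacent⇒distinct {x} xy refl with trans (sym (adj-irr G x)) xy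
  ... | ()

  x∈N⁺ : ∀ {w x} → adj G w x ≡ true → x ∈ N G w
  x∈N⁺ {w} {x} wx = lookup⇒[]= x (N G w) (trans (lookup∘tabulate (adj G w) x) wx)

  x∈N⁻ : ∀ {w x} → x ∈ N G w → adj G w x ≡ true
  x∈N⁻ {w} {x} x∈N = trans (sym (lookup∘tabulate (adj G w) x)) ([]=⇒lookup x∈N)

  x∈N[]⁺ : ∀ {w x} → adj G w x ≡ true ⊎ x ≡ w → x ∈ N[_] G w
  x∈N[]⁺ (inj₁ wx) = x∈p∪q⁺ (inj₁ (x∈N⁺ wx))
  x∈N[]⁺ {w} (inj₂ refl) = x∈p∪q⁺ {p = N G w} (inj₂ (x∈⁅x⁆ w))

  x∈N[]⁻ : ∀ {w x} → x ∈ N[_] G w → adj G w x ≡ true ⊎ x ≡ w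
  x∈N[]⁻ {w} x∈N[w] with x∈p∪q⁻ (N G w) _ x∈N[w]
  ... | inj₁ x∈N = inj₁ (x∈N⁻ x∈N)
  ... | inj₂ x∈⁅w⁆ = inj₂ (x∈⁅y⁆⇒x≡y w x∈⁅w⁆)

  x∉N[]⁻ : ∀ {w x} → x ∉ N[_] G w → adj G w x ≡ false × x ≢ w
  x∉N[]⁻ {w} {x} x∉N[w] = nonadjacent , x∉N[w] ∘ x∈N[]⁺ ∘ inj₂
    where
      nonadjacent : adj G w x ≡ false
      nonadjacent with adj G w x in wx
      ... | true = ⊥-elim (x∉N[w] (x∈N[]⁺ (inj₁ wx)))
      ... | false = refl

  x∈N[]⇒x∈N : ∀ {w x} → x ∈ N[_] G w → x ≢ w → x ∈ N G w
  x∈N[]⇒x∈N x∈N[w] x≢w with x∈N[]⁻ x∈N[w]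
  ... | inj₁ wx = x∈N⁺ wx
  ... | inj₂ x≡w = ⊥-elim (x≢w x≡w)

  independenceNumber-mono : ∀ {q A B} → A ⊆ B →
    IndependenceNumberAtMost G q B → IndependenceNumberAtMost G q A
  independenceNumber-mono A⊆B bound f f-inj f∈A = bound f f-inj (A⊆B ∘ f∈A)

  independent⇒∣∣≤ : ∀ {q A} → IndependenceNumberAtMost G q A → IsIndependent G A → ∣ A ∣ ≤ q
  independent⇒∣∣≤ {q} {A} bound independent with ∣ A ∣ ≤? q
  ... | yes ∣A∣≤q = ∣A∣≤q
  ... | no ∣A∣≰q with ≤∣p∣⇒injection A (suc q) (≰⇒> ∣A∣≰q)
  ... | f , f-inj , f∈A =
    ⊥-elim (bound f f-inj f∈A λ i j → independent (f i) (f j) (f∈A i) (f∈A j))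

  starFree⇒independenceNumber-N : ∀ {m} → InducedFree G (starAdj (suc m)) →
    ∀ c → IndependenceNumberAtMost G m (N G c)
  starFree⇒independenceNumber-N {m} starFree c f f-inj f∈N f-independent =
    starFree g g-inj g-adj
    where
      c-adj : ∀ i → adj G c (f i) ≡ true
      c-adj i = x∈N⁻ (f∈N i)
      g : Fin (suc (suc m)) → Fin n
      g zero = c
      g (suc i) = f i
      g-inj : Injective _≡_ _≡_ g
      g-inj {zero} {zero} _ = refl
      g-inj {zero} {suc j} e = ⊥-elim (adjacent⇒distinct (c-adj j) e)
      g-inj {suc i} {zero} e = ⊥-elim (adjacent⇒distinct (c-adj i) (sym e))
      g-inj {suc i} {suc j} e = cong suc (f-inj e)
      g-adj : ∀ i j → adj G (g i) (g j) ≡ starAdj (suc m) i j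
      g-adj zero zero = adj-irr G c
      g-adj zero (suc j) = c-adj j
      g-adj (suc i) zero = trans (adj-sym G (f i) c) (c-adj i)
      g-adj (suc i) (suc j) = f-independent i j

  diamondFree⇒commonNeighbours-nonadjacent : InducedFree G diamondAdj →
    ∀ {a b c d} → a ≢ d → adj G a d ≡ false →
    adj G a b ≡ true → adj G d b ≡ true → adj G a c ≡ true → adj G d c ≡ true →
    adj G b c ≡ false
  diamondFree⇒commonNeighbours-nonadjacent diamondFree {a} {b} {c} {d} a≢d ad ab db ac dc
    with adj G b c in bc
  ... | false = refl
  ... | true = ⊥-elim (diamondFree g g-inj g-adj)
    where
      g : Fin 4 → Fin n
      g zero = a
      g (suc zero) = b
      g (suc (suc zero)) = c
      g (suc (suc (suc zero))) = d
      g-adj : ∀ i j → adj G (g i) (g j) ≡ diamondAdj i j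
      g-adj zero zero = adj-irr G a
      g-adj zero (suc zero) = ab
      g-adj zero (suc (suc zero)) = ac
      g-adj zero (suc (suc (suc zero))) = ad
      g-adj (suc zero) zero = trans (adj-sym G b a) ab
      g-adj (suc zero) (suc zero) = adj-irr G b
      g-adj (suc zero) (suc (suc zero)) = bc
      g-adj (suc zero) (suc (suc (suc zero))) = trans (adj-sym G b d) db
      g-adj (suc (suc zero)) zero = trans (adj-sym G c a) ac
      g-adj (suc (suc zero)) (suc zero) = trans (adj-sym G c b) bc
      g-adj (suc (suc zero)) (suc (suc zero)) = adj-irr G c
      g-adj (suc (suc zero)) (suc (suc (suc zero))) = trans (adj-sym G c d) dc
      g-adj (suc (suc (suc zero))) zero = trans (adj-sym G d a) ad
      g-adj (suc (suc (suc zero))) (suc zero) = db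
      g-adj (suc (suc (suc zero))) (suc (suc zero)) = dc
      g-adj (suc (suc (suc zero))) (suc (suc (suc zero))) = adj-irr G d
      g-inj : Injective _≡_ _≡_ g
      g-inj {zero} {zero} _ = refl
      g-inj {zero} {suc zero} e = ⊥-elim (adjacent⇒distinct (g-adj _ _) e)
      g-inj {zero} {suc (suc zero)} e = ⊥-elim (adjacent⇒distinct (g-adj _ _) e)
      g-inj {zero} {suc (suc (suc zero))} e = ⊥-elim (a≢d e)
      g-inj {suc zero} {zero} e = ⊥-elim (adjacent⇒distinct (g-adj _ _) e)
      g-inj {suc zero} {suc zero} _ = refl
      g-inj {suc zero} {suc (suc zero)} e = ⊥-elim (adjacent⇒distinct (g-adj _ _) e)
      g-inj {suc zero} {suc (suc (suc zero))} e = ⊥-elim (adjacent⇒distinct (g-adj _ _) e)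
      g-inj {suc (suc zero)} {zero} e = ⊥-elim (adjacent⇒distinct (g-adj _ _) e)
      g-inj {suc (suc zero)} {suc zero} e = ⊥-elim (adjacent⇒distinct (g-adj _ _) e)
      g-inj {suc (suc zero)} {suc (suc zero)} _ = refl
      g-inj {suc (suc zero)} {suc (suc (suc zero))} e = ⊥-elim (adjacent⇒distinct (g-adj _ _) e)
      g-inj {suc (suc (suc zero))} {zero} e = ⊥-elim (a≢d (sym e))
      g-inj {suc (suc (suc zero))} {suc zero} e = ⊥-elim (adjacent⇒distinct (g-adj _ _) e)
      g-inj {suc (suc (suc zero))} {suc (suc zero)} e = ⊥-elim (adjacent⇒distinct (g-adj _ _) e)
      g-inj {suc (suc (suc zero))} {suc (suc (suc zero))} _ = refl

module _ {n : ℕ} (G : Graph n) (S : Subset n) where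

  ⊕-adjˡ-∉ : ∀ {x y} → x ∉ S → adj (G ⊕ S) x y ≡ adj G x y
  ⊕-adjˡ-∉ x∉S rewrite x∉p⇒lookup≡false S x∉S = refl

  ⊕-adjʳ-∉ : ∀ {x y} → y ∉ S → adj (G ⊕ S) x y ≡ adj G x y
  ⊕-adjʳ-∉ {x} y∉S rewrite x∉p⇒lookup≡false S y∉S | ∧-zeroʳ (lookup S x) = refl

  ⊕-adj-∈ : ∀ {x y} → x ∈ S → y ∈ S → x ≢ y → adj (G ⊕ S) x y ≡ not (adj G x y)
  ⊕-adj-∈ {x} {y} x∈S y∈S x≢y rewrite []=⇒lookup x∈S | []=⇒lookup y∈S with x ≟ y
  ... | yes x≡y = ⊥-elim (x≢y x≡y)
  ... | no _ = ∧-identityʳ _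

  ⊕-adj-∈N-∉ : ∀ {w x} → x ∉ S → x ∈ N G w → adj (G ⊕ S) w x ≡ true
  ⊕-adj-∈N-∉ x∉S x∈N = trans (⊕-adjʳ-∉ x∉S) (x∈N⁻ G x∈N)

  ⊕-adj-∉N[]-∈ : ∀ {w x} → w ∈ S → x ∈ S → x ∉ N[_] G w → adj (G ⊕ S) w x ≡ true
  ⊕-adj-∉N[]-∈ w∈S x∈S x∉N[w] with x∉N[]⁻ G x∉N[w]
  ... | wx , x≢w = trans (⊕-adj-∈ w∈S x∈S (x≢w ∘ sym)) (cong not wx)

  independenceNumber-⊕-∉ : ∀ {q A} → (∀ {x} → x ∈ A → x ∉ S) →
    IndependenceNumberAtMost (G ⊕ S) q A → IndependenceNumberAtMost G q A
  independenceNumber-⊕-∉ A∩S≡∅ bound f f-inj f∈A f-independent =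
    bound f f-inj f∈A λ i j → trans (⊕-adjˡ-∉ (A∩S≡∅ (f∈A i))) (f-independent i j)

  independenceNumber-⊕-∈ : ∀ {q A} → A ⊆ S →
    IndependenceNumberAtMost (G ⊕ S) q A → CliqueNumberAtMost G q A
  independenceNumber-⊕-∈ A⊆S bound f f-inj f∈A f-clique = bound f f-inj f∈A ⊕-independent
    where
      ⊕-independent : ∀ i j → adj (G ⊕ S) (f i) (f j) ≡ false
      ⊕-independent i j with i ≟ j
      ... | yes refl = adj-irr (G ⊕ S) (f i)
      ... | no i≢j = trans (⊕-adj-∈ (A⊆S (f∈A i)) (A⊆S (f∈A j)) (i≢j ∘ f-inj))
                           (cong not (f-clique i j i≢j))

module InClassG-⊕ (m : ℕ) {n : ℕ} (G : Graph n) (S : Subset n)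
  (starFree : InducedFree (G ⊕ S) (starAdj (suc m)))
  (diamondFree : InducedFree (G ⊕ S) diamondAdj) where

  ⊕-commonNeighbours-of-edge-nonadjacent : ∀ {a b c d} → a ∈ S → d ∈ S → adj G a d ≡ true →
    adj (G ⊕ S) a b ≡ true → adj (G ⊕ S) d b ≡ true →
    adj (G ⊕ S) a c ≡ true → adj (G ⊕ S) d c ≡ true → adj (G ⊕ S) b c ≡ false
  ⊕-commonNeighbours-of-edge-nonadjacent a∈S d∈S ad =
    diamondFree⇒commonNeighbours-nonadjacent (G ⊕ S) diamondFree a≢d
      (trans (⊕-adj-∈ G S a∈S d∈S a≢d) (cong not ad))
    where
      a≢d = adjacent⇒distinct G ad

  commonNeighbours-∉-independent : ∀ {a d I} → a ∈ S → d ∈ S → adj G a d ≡ true →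
    I ⊆ N G a ∩ N G d → (∀ {x} → x ∈ I → x ∉ S) → IsIndependent G I
  commonNeighbours-∉-independent {a} {d} {I} a∈S d∈S ad I⊆N I∩S≡∅ x y x∈I y∈I =
    trans (sym (⊕-adjˡ-∉ G S (I∩S≡∅ x∈I)))
      (⊕-commonNeighbours-of-edge-nonadjacent a∈S d∈S ad
        (a-adj x∈I) (d-adj x∈I) (a-adj y∈I) (d-adj y∈I))
    where
      a-adj : ∀ {z} → z ∈ I → adj (G ⊕ S) a z ≡ true
      a-adj z∈I = ⊕-adj-∈N-∉ G S (I∩S≡∅ z∈I) (proj₁ (x∈p∩q⁻ (N G a) (N G d) (I⊆N z∈I)))
      d-adj : ∀ {z} → z ∈ I → adj (G ⊕ S) d z ≡ true
      d-adj z∈I = ⊕-adj-∈N-∉ G S (I∩S≡∅ z∈I) (proj₂ (x∈p∩q⁻ (N G a) (N G d) (I⊆N z∈I)))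

  commonNonNeighbours-∈-clique : ∀ {a d K} → a ∈ S → d ∈ S → adj G a d ≡ true →
    K ⊆ S → K ⊆ ∁ (N[_] G a) ∩ ∁ (N[_] G d) → IsClique G K
  commonNonNeighbours-∈-clique {a} {d} {K} a∈S d∈S ad K⊆S K⊆∁N[] x y x∈K y∈K x≢y = begin
    adj G x y                ≡⟨ not-involutive _ ⟨
    not (not (adj G x y))    ≡⟨ cong not (⊕-adj-∈ G S (K⊆S x∈K) (K⊆S y∈K) x≢y) ⟨
    not (adj (G ⊕ S) x y)    ≡⟨ cong not (⊕-commonNeighbours-of-edge-nonadjacent a∈S d∈S ad
                                  (a-adj x∈K) (d-adj x∈K) (a-adj y∈K) (d-adj y∈K)) ⟩
    true                     ∎
    where
      a-adj : ∀ {z} → z ∈ K → adj (G ⊕ S) a z ≡ true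
      a-adj z∈K = ⊕-adj-∉N[]-∈ G S a∈S (K⊆S z∈K)
        (x∈∁p⇒x∉p (proj₁ (x∈p∩q⁻ (∁ (N[_] G a)) (∁ (N[_] G d)) (K⊆∁N[] z∈K))))
      d-adj : ∀ {z} → z ∈ K → adj (G ⊕ S) d z ≡ true
      d-adj z∈K = ⊕-adj-∉N[]-∈ G S d∈S (K⊆S z∈K)
        (x∈∁p⇒x∉p (proj₂ (x∈p∩q⁻ (∁ (N[_] G a)) (∁ (N[_] G d)) (K⊆∁N[] z∈K))))

  ⊕-independenceNumber-N : ∀ c → IndependenceNumberAtMost (G ⊕ S) m (N (G ⊕ S) c)
  ⊕-independenceNumber-N = starFree⇒independenceNumber-N (G ⊕ S) starFree

  privateNeighbourhood-isSplitPartition : ∀ {u v} → u ∈ S → v ∈ S →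
    IsPQSplitPartitionOf G m m (N G u ─ N[_] G v)
      (S ∩ (N G u ─ N[_] G v)) ((N G u ─ N[_] G v) ─ S)
  privateNeighbourhood-isSplitPartition {u} {v} u∈S v∈S =
    isPartition G (p∩q⊆q S X) (p─q⊆p X S) outside-S disjoint ,
    independenceNumber-⊕-∈ G S (p∩q⊆p S X)
      (independenceNumber-mono (G ⊕ S) S∩X⊆N⊕v (⊕-independenceNumber-N v)) ,
    independenceNumber-⊕-∉ G S x∈p─q⇒x∉q
      (independenceNumber-mono (G ⊕ S) X─S⊆N⊕u (⊕-independenceNumber-N u))
    where
      X = N G u ─ N[_] G v
      outside-S : ∀ {x} → x ∈ X → x ∉ S ∩ X → x ∈ X ─ S
      outside-S x∈X x∉S∩X = x∈p∧x∉q⇒x∈p─q x∈X (x∉S∩X ∘ x∈p∩q⁺ ∘ (_, x∈X))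
      disjoint : ∀ {x} → x ∈ S ∩ X → x ∉ X ─ S
      disjoint x∈S∩X x∈X─S = x∈p─q⇒x∉q x∈X─S (proj₁ (x∈p∩q⁻ S X x∈S∩X))
      S∩X⊆N⊕v : S ∩ X ⊆ N (G ⊕ S) v
      S∩X⊆N⊕v x∈S∩X = x∈N⁺ (G ⊕ S) (⊕-adj-∉N[]-∈ G S v∈S
        (proj₁ (x∈p∩q⁻ S X x∈S∩X)) (x∈p─q⇒x∉q (proj₂ (x∈p∩q⁻ S X x∈S∩X))))
      X─S⊆N⊕u : X ─ S ⊆ N (G ⊕ S) u
      X─S⊆N⊕u x∈X─S = x∈N⁺ (G ⊕ S)
        (⊕-adj-∈N-∉ G S (x∈p─q⇒x∉q x∈X─S) (p─q⊆p (N G u) _ (p─q⊆p X S x∈X─S)))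

  commonNeighbourhood─S-independent-≤ : ∀ {u v} → u ∈ S → v ∈ S → adj G u v ≡ true →
    IsIndependent G ((N G u ∩ N G v) ─ S) × ∣ (N G u ∩ N G v) ─ S ∣ ≤ m
  commonNeighbourhood─S-independent-≤ {u} {v} u∈S v∈S uv =
    independent , independent⇒∣∣≤ G bound independent
    where
      A = (N G u ∩ N G v) ─ S
      independent : IsIndependent G A
      independent = commonNeighbours-∉-independent u∈S v∈S uv (p─q⊆p _ S) x∈p─q⇒x∉q
      A⊆N⊕u : A ⊆ N (G ⊕ S) u
      A⊆N⊕u x∈A = x∈N⁺ (G ⊕ S)
        (⊕-adj-∈N-∉ G S (x∈p─q⇒x∉q x∈A) (p∩q⊆p (N G u) (N G v) (p─q⊆p _ S x∈A)))
      bound : IndependenceNumberAtMost G m A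
      bound = independenceNumber-⊕-∉ G S x∈p─q⇒x∉q
        (independenceNumber-mono (G ⊕ S) A⊆N⊕u (⊕-independenceNumber-N u))

  module _ {u v : Fin n} (u∈S : u ∈ S) (v∈S : v ∈ S) (uv : adj G u v ≡ true) where

    private
      C = ∁ (N[_] G u) ∩ ∁ (N[_] G v)
      K = S ∩ C

    farNeighbourhood-clique : IsClique G K
    farNeighbourhood-clique = commonNonNeighbours-∈-clique u∈S v∈S uv (p∩q⊆p S C) (p∩q⊆q S C)

    farNeighbourhood-isSplitPartition : ∀ x y → x ∈ K → y ∈ K → adj G x y ≡ true →
      IsSplitPartitionOf G (N[_] G x ∩ N[_] G y ∩ C) K ((N[_] G x ∩ N[_] G y ∩ C) ─ K)
    farNeighbourhood-isSplitPartition x y x∈K y∈K xy =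
      isPartition G K⊆J (p─q⊆p J K) x∈p∧x∉q⇒x∈p─q (λ z∈K z∈J─K → x∈p─q⇒x∉q z∈J─K z∈K) ,
      farNeighbourhood-clique ,
      commonNeighbours-∉-independent x∈S y∈S xy J─K⊆N J─K∩S≡∅
      where
        J = N[_] G x ∩ N[_] G y ∩ C
        x∈S = p∩q⊆p S C x∈K
        y∈S = p∩q⊆p S C y∈K
        K⊆N[] : ∀ {w z} → w ∈ K → z ∈ K → z ∈ N[_] G w
        K⊆N[] {w} {z} w∈K z∈K with z ≟ w
        ... | yes z≡w = x∈N[]⁺ G (inj₂ z≡w)
        ... | no z≢w = x∈N[]⁺ G (inj₁ (farNeighbourhood-clique w z w∈K z∈K (z≢w ∘ sym)))
        K⊆J : K ⊆ J
        K⊆J z∈K = x∈p∩q⁺ (K⊆N[] x∈K z∈K , x∈p∩q⁺ (K⊆N[] y∈K z∈K , p∩q⊆q S C z∈K))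
        J─K∩S≡∅ : ∀ {z} → z ∈ J ─ K → z ∉ S
        J─K∩S≡∅ z∈J─K z∈S = x∈p─q⇒x∉q z∈J─K
          (x∈p∩q⁺ (z∈S , p∩q⊆q (N[_] G y) C (p∩q⊆q (N[_] G x) _ (p─q⊆p J K z∈J─K))))
        ∈N[]─S⇒∈N : ∀ {w z} → w ∈ S → z ∉ S → z ∈ N[_] G w → z ∈ N G w
        ∈N[]─S⇒∈N w∈S z∉S z∈N[w] = x∈N[]⇒x∈N G z∈N[w] (λ { refl → z∉S w∈S })
        J─K⊆N : J ─ K ⊆ N G x ∩ N G y
        J─K⊆N z∈J─K = x∈p∩q⁺ (∈N[]─S⇒∈N x∈S z∉S z∈N[x] , ∈N[]─S⇒∈N y∈S z∉S z∈N[y])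
          where
            z∉S = J─K∩S≡∅ z∈J─K
            z∈J = p─q⊆p J K z∈J─K
            z∈N[x] = p∩q⊆p (N[_] G x) _ z∈J
            z∈N[y] = p∩q⊆p (N[_] G y) C (p∩q⊆q (N[_] G x) _ z∈J)

mainTheorem6 : (t : ℕ) → 3 ≤ t → {n : ℕ} → (G : Graph n) → (S : Subset n) →
    2 ≤ ∣ S ∣ → InClassG t (G ⊕ S) → ¬ IsIndependent G S →
    (u v : Fin n) → u ∈ S → v ∈ S → adj G u v ≡ true →
    IsPQSplitPartitionOf G (t ∸ 1) (t ∸ 1) (N G u ─ N[_] G v)
      (S ∩ (N G u ─ N[_] G v)) ((N G u ─ N[_] G v) ─ S)
    × IsPQSplitPartitionOf G (t ∸ 1) (t ∸ 1) (N G v ─ N[_] G u)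
      (S ∩ (N G v ─ N[_] G u)) ((N G v ─ N[_] G u) ─ S)
    × (IsIndependent G ((N G u ∩ N G v) ─ S) × ∣ (N G u ∩ N G v) ─ S ∣ ≤ t ∸ 1)
    × (IsClique G (S ∩ ∁ (N[_] G u) ∩ ∁ (N[_] G v))
       × ((x y : Fin n) → x ∈ S ∩ ∁ (N[_] G u) ∩ ∁ (N[_] G v) →
          y ∈ S ∩ ∁ (N[_] G u) ∩ ∁ (N[_] G v) → adj G x y ≡ true →
          IsSplitPartitionOf G
            (N[_] G x ∩ N[_] G y ∩ ∁ (N[_] G u) ∩ ∁ (N[_] G v))
            (S ∩ ∁ (N[_] G u) ∩ ∁ (N[_] G v))
            ((N[_] G x ∩ N[_] G y ∩ ∁ (N[_] G u) ∩ ∁ (N[_] G v))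
              ─ (S ∩ ∁ (N[_] G u) ∩ ∁ (N[_] G v)))))
mainTheorem6 (suc t) _ G S _ (starFree , diamondFree) _ u v u∈S v∈S uv =
  privateNeighbourhood-isSplitPartition u∈S v∈S ,
  privateNeighbourhood-isSplitPartition v∈S u∈S ,
  commonNeighbourhood─S-independent-≤ u∈S v∈S uv ,
  farNeighbourhood-clique u∈S v∈S uv ,
  farNeighbourhood-isSplitPartition u∈S v∈S uv
  where
    open InClassG-⊕ t G S starFree diamondFree
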